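{- If $\mathsf{Kt}2\vdash A$ then $\mathfrak{R}\models A$ for every relational model $\mathfrak{R}$.
   Context: Formulas: $A ::= P \mid X \mid A\to B \mid \Box A \mid \blacksquare A \mid \forall X A$, with $\bot := \forall XX$, $\neg A := A\to\bot$, $\Diamond A := \forall X(\Box(A\to\blacksquare X)\to X)$, backward diamond $\Diamond^{\bullet}A := \forall X(\blacksquare(A\to\Box X)\to X)$. $\mathsf{IKt}2$: second-order intuitionistic propositional logic (with full comprehension $\forall XA\to A[C/X]$, modus ponens, generalisation with fresh propositional symbol), distribution axioms for $\Box,\Diamond,\blacksquare,\Diamond^{\bullet}$ (namely $\Box(A\to B)\to\Box A\to\Box B$, $\Box(A\to B)\to\Diamond A\to\Diamond B$, $\blacksquare(A\to B)\to\blacksquare A\to\blacksquare B$, $\blacksquare(A\to B)\to\Diamond^{\bullet}A\to\Diamond^{\bullet}B$), necessitation for $\Box$ and $\blacksquare$, and tense axioms $\Diamond^{\bullet}\Box A\to A$, $A\to\Box\Diamond^{\bullet}A$, $\Diamond\blacksquare A\to A$, $A\to\blacksquare\Diamond A$. $\mathsf{Kt}2 := \mathsf{IKt}2+(\neg\neg A\to A)$. A relational model: set $W$ of worlds, class $\mathcal{W}\subseteq\mathcal{P}(W)$ of sets, interpretations $P_{\mathfrak{R}}\in\mathcal{W}$, relation $R\subseteq W\times W$; classical satisfaction ($v\models A\to B$ iff $v\models A$ implies $v\models B$; $v\models\Box A$ iff $w\models A$ for all $vRw$; $v\models\blacksquare A$ iff $u\models A$ for all $uRv$; $v\models\forall XA$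 iff $v\models A[V/X]$ for all $V\in\mathcal{W}$; $v\models P$ iff $v\in P_{\mathfrak{R}}$), and comprehensive: $\{w: w\models C\}\in\mathcal{W}$ for every closed formula $C$ (with sets treated as symbols interpreted by themselves). $\mathfrak{R}\models A$ means every world satisfies $A$. -}

module Defs where

open import Data.Nat using (ℕ; zero; suc)
open import Data.Fin using (Fin; zero; suc)
open import Data.Product using (Σ; _×_; _,_)
open import Data.Unit using (⊤)
open import Relation.Nullary using (¬_)
open import Relation.Binary.PropositionalEquality using (_≡_)
open import Function.Bundles using (_⇔_)

-- Formulas over a type `At` of propositional symbols (atoms),
-- with second-order propositional variables as de Bruijn indices:
-- `Form At n` = formulas with at most n bound variables in scope.

infixr 5 _⇒_

data Form (At : Set) : ℕ → Set where
  atom : ∀ {n} → At → Form At n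
  var  : ∀ {n} → Fin n → Form At n
  _⇒_  : ∀ {n} → Form At n → Form At n → Form At n
  □    : ∀ {n} → Form At n → Form At n
  ■    : ∀ {n} → Form At n → Form At n
  ∀'   : ∀ {n} → Form At (suc n) → Form At n

ext : ∀ {n m} → (Fin n → Fin m) → Fin (suc n) → Fin (suc m)
ext ρ zero    = zero
ext ρ (suc i) = suc (ρ i)

rename : ∀ {At n m} → (Fin n → Fin m) → Form At n → Form At m
rename ρ (atom p) = atom p
rename ρ (var x)  = var (ρ x)
rename ρ (A ⇒ B)  = rename ρ A ⇒ rename ρ B
rename ρ (□ A)    = □ (rename ρ A)
rename ρ (■ A)    = ■ (rename ρ A)
rename ρ (∀' A)   = ∀' (rename (ext ρ) A)

wk : ∀ {At n} → Form At n → Form At (suc n)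
wk = rename suc

exts : ∀ {At n m} → (Fin n → Form At m) → Fin (suc n) → Form At (suc m)
exts σ zero    = var zero
exts σ (suc i) = wk (σ i)

subst : ∀ {At n m} → (Fin n → Form At m) → Form At n → Form At m
subst σ (atom p) = atom p
subst σ (var x)  = σ x
subst σ (A ⇒ B)  = subst σ A ⇒ subst σ B
subst σ (□ A)    = □ (subst σ A)
subst σ (■ A)    = ■ (subst σ A)
subst σ (∀' A)   = ∀' (subst (exts σ) A)

_[_] : ∀ {At} → Form At 1 → Form At 0 → Form At 0
A [ C ] = subst (λ { zero → C }) A

⊥' : ∀ {At n} → Form At n
⊥' = ∀' (var zero)

¬' : ∀ {At n} → Form At n → Form At n
¬' A = A ⇒ ⊥'

◇ : ∀ {At n} → Form At n → Form At n
◇ A = ∀' (□ (wk A ⇒ ■ (var zero)) ⇒ var zero)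

◆ : ∀ {At n} → Form At n → Form At n
◆ A = ∀' (■ (wk A ⇒ □ (var zero)) ⇒ var zero)

Fresh : ∀ {At n} → At → Form At n → Set
Fresh p (atom q) = ¬ (p ≡ q)
Fresh p (var x)  = ⊤
Fresh p (A ⇒ B)  = Fresh p A × Fresh p B
Fresh p (□ A)    = Fresh p A
Fresh p (■ A)    = Fresh p A
Fresh p (∀' A)   = Fresh p A

Fml : Set
Fml = Form ℕ 0

-- The Hilbert system Kt2 = IKt2 + (¬¬A → A), on closed formulas.

infix 3 Kt2⊢_

data Kt2⊢_ : Fml → Set where
  ax-K    : ∀ A B → Kt2⊢ A ⇒ B ⇒ A
  ax-S    : ∀ A B C → Kt2⊢ (A ⇒ B ⇒ C) ⇒ (A ⇒ B) ⇒ A ⇒ C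
  ax-inst : ∀ (A : Form ℕ 1) (C : Fml) → Kt2⊢ ∀' A ⇒ A [ C ]
  ax-∀⇒   : ∀ (B : Fml) (A : Form ℕ 1) → Kt2⊢ ∀' (wk B ⇒ A) ⇒ B ⇒ ∀' A
  mp      : ∀ {A B} → Kt2⊢ A ⇒ B → Kt2⊢ A → Kt2⊢ B
  gen     : ∀ (p : ℕ) (A : Form ℕ 1) → Fresh p A → Kt2⊢ A [ atom p ] → Kt2⊢ ∀' A
  ax-□    : ∀ A B → Kt2⊢ □ (A ⇒ B) ⇒ □ A ⇒ □ B
  ax-◇    : ∀ A B → Kt2⊢ □ (A ⇒ B) ⇒ ◇ A ⇒ ◇ B
  ax-■    : ∀ A B → Kt2⊢ ■ (A ⇒ B) ⇒ ■ A ⇒ ■ B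
  ax-◆    : ∀ A B → Kt2⊢ ■ (A ⇒ B) ⇒ ◆ A ⇒ ◆ B
  nec-□   : ∀ {A} → Kt2⊢ A → Kt2⊢ □ A
  nec-■   : ∀ {A} → Kt2⊢ A → Kt2⊢ ■ A
  ax-t1   : ∀ A → Kt2⊢ ◆ (□ A) ⇒ A
  ax-t2   : ∀ A → Kt2⊢ A ⇒ □ (◆ A)
  ax-t3   : ∀ A → Kt2⊢ ◇ (■ A) ⇒ A
  ax-t4   : ∀ A → Kt2⊢ A ⇒ ■ (◇ A)
  ax-dne  : ∀ A → Kt2⊢ ¬' (¬' A) ⇒ A

-- Relational models.  The class 𝒲 ⊆ P(W) is given as an indexed family
-- of subsets  set : Idx → W → Set  (membership of V in 𝒲 = being some set i).

record RelModel : Set₁ where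
  field
    W    : Set
    Idx  : Set
    set  : Idx → W → Set
    val  : ℕ → Idx
    R    : W → W → Set

  -- classical satisfaction for formulas whose atoms are sets of 𝒲
  -- (sets treated as symbols interpreted by themselves); ρ interprets
  -- the bound variables currently in scope.
  Sat : ∀ {n} → (Fin n → Idx) → W → Form Idx n → Set
  Sat ρ v (atom i) = set i v
  Sat ρ v (var x)  = set (ρ x) v
  Sat ρ v (A ⇒ B)  = Sat ρ v A → Sat ρ v B
  Sat ρ v (□ A)    = ∀ w → R v w → Sat ρ w A
  Sat ρ v (■ A)    = ∀ u → R u v → Sat ρ u A
  Sat ρ v (∀' A)   = ∀ (i : Idx) → Sat (λ { zero → i ; (suc x) → ρ x }) v A

  _⊨_ : W → Form Idx 0 → Set
  v ⊨ A = Sat (λ ()) v A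

  interp : ∀ {n} → Form ℕ n → Form Idx n
  interp (atom p) = atom (val p)
  interp (var x)  = var x
  interp (A ⇒ B)  = interp A ⇒ interp B
  interp (□ A)    = □ (interp A)
  interp (■ A)    = ■ (interp A)
  interp (∀' A)   = ∀' (interp A)

  Comprehensive : Set
  Comprehensive = ∀ (C : Form Idx 0) → Σ Idx λ i → ∀ w → set i w ⇔ (w ⊨ C)

  Valid : Fml → Set
  Valid A = ∀ w → w ⊨ interp A

-- Soundness is proved by induction on derivations, uniformly in the valuation
-- of the propositional symbols, so that the rule of generalisation can be
-- discharged by revaluing its fresh symbol P as an arbitrary set V ∈ 𝒲.
-- Comprehensiveness is what makes comprehension sound: the truth set of the
-- instantiating formula is a member of 𝒲, hence a value of the bound
-- variable.  The tense axioms ◆□A → A and ◇■A → A are instances of the same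
-- idea (take X := A), and ¬¬A → A holds because the satisfaction clauses are
-- classical.
module Submission where

open import Defs
open import Level using (0ℓ)
open import Axiom.ExcludedMiddle using (ExcludedMiddle)
open import Data.Nat using (ℕ)
open import Data.Nat.Properties using (_≟_)
open import Data.Fin using (Fin; zero; suc)
open import Data.Product using (_,_; proj₁; proj₂)
open import Data.Empty using (⊥-elim)
open import Relation.Nullary using (¬_; yes; no)
open import Relation.Binary.PropositionalEquality as ≡ using (_≡_; refl; cong; cong₂)
open import Function.Bundles using (_⇔_; mk⇔; module Equivalence)
import Function.Properties.Equivalence as ⇔
open import Function.Related.TypeIsomorphisms using (→-cong-⇔)

open Equivalence using (to; from)

∀-cong-⇔ : {X : Set} {B C : X → Set} → (∀ x → B x ⇔ C x) → (∀ x → B x) ⇔ (∀ x → C x)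
∀-cong-⇔ B⇔C = mk⇔ (λ f x → to (B⇔C x) (f x)) (λ g x → from (B⇔C x) (g x))

guarded-cong-⇔ : {X : Set} {P B C : X → Set} →
                 (∀ x → B x ⇔ C x) → (∀ x → P x → B x) ⇔ (∀ x → P x → C x)
guarded-cong-⇔ B⇔C = ∀-cong-⇔ λ x → →-cong-⇔ ⇔.refl (B⇔C x)

_[_↦_] : {I : Set} → (ℕ → I) → ℕ → I → ℕ → I
(f [ p ↦ i ]) q with q ≟ p
... | yes _ = i
... | no _  = f q

[↦]-same : {I : Set} (f : ℕ → I) (p : ℕ) (i : I) → (f [ p ↦ i ]) p ≡ i
[↦]-same f p i with p ≟ p
... | yes _  = refl
... | no p≢p = ⊥-elim (p≢p refl)

[↦]-other : {I : Set} (f : ℕ → I) {p : ℕ} (i : I) {q : ℕ} → ¬ p ≡ q → (f [ p ↦ i ]) q ≡ f q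
[↦]-other f {p} i {q} p≢q with q ≟ p
... | yes q≡p = ⊥-elim (p≢q (≡.sym q≡p))
... | no _    = refl

module Semantics (M : RelModel) where
  open RelModel M

  -- Satisfaction stays that of M; by record η, ⟦ A ⟧⟨ val ⟩ is interp A.
  ⟦_⟧⟨_⟩ : ∀ {n} → Form ℕ n → (ℕ → Idx) → Form Idx n
  ⟦ A ⟧⟨ f ⟩ = RelModel.interp (record M { val = f }) A

  ⟦⟧-fresh : ∀ (f : ℕ → Idx) {p} i {n} (A : Form ℕ n) → Fresh p A →
             ⟦ A ⟧⟨ f [ p ↦ i ] ⟩ ≡ ⟦ A ⟧⟨ f ⟩
  ⟦⟧-fresh f i (atom q) p≢q      = cong atom ([↦]-other f i p≢q)
  ⟦⟧-fresh f i (var x)  _        = refl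
  ⟦⟧-fresh f i (A ⇒ B)  (pA , pB) = cong₂ _⇒_ (⟦⟧-fresh f i A pA) (⟦⟧-fresh f i B pB)
  ⟦⟧-fresh f i (□ A)    pA       = cong □ (⟦⟧-fresh f i A pA)
  ⟦⟧-fresh f i (■ A)    pA       = cong ■ (⟦⟧-fresh f i A pA)
  ⟦⟧-fresh f i (∀' A)   pA       = cong ∀' (⟦⟧-fresh f i A pA)

  Sat-rename : ∀ {f n m} (r : Fin n → Fin m) {ρ : Fin n → Idx} {ρ′ : Fin m → Idx} →
               (∀ x w → set (ρ′ (r x)) w ⇔ set (ρ x) w) →
               ∀ (A : Form ℕ n) v → Sat ρ′ v ⟦ rename r A ⟧⟨ f ⟩ ⇔ Sat ρ v ⟦ A ⟧⟨ f ⟩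
  Sat-rename r h (atom p) v = ⇔.refl
  Sat-rename r h (var x)  v = h x v
  Sat-rename r h (A ⇒ B)  v = →-cong-⇔ (Sat-rename r h A v) (Sat-rename r h B v)
  Sat-rename r h (□ A)    v = guarded-cong-⇔ λ w → Sat-rename r h A w
  Sat-rename r h (■ A)    v = guarded-cong-⇔ λ u → Sat-rename r h A u
  Sat-rename r h (∀' A)   v = ∀-cong-⇔ λ i → Sat-rename (ext r) (λ { zero _ → ⇔.refl ; (suc x) → h x }) A v

  Sat-wk : ∀ {f} (A : Fml) {ρ : Fin 1 → Idx} v → Sat ρ v ⟦ wk A ⟧⟨ f ⟩ ⇔ v ⊨ ⟦ A ⟧⟨ f ⟩
  Sat-wk A v = Sat-rename suc (λ ()) A v

  Sat-subst : ∀ {f n m} (σ : Fin n → Form ℕ m) {ρ : Fin n → Idx} {ρ′ : Fin m → Idx} →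
              (∀ x w → set (ρ x) w ⇔ Sat ρ′ w ⟦ σ x ⟧⟨ f ⟩) →
              ∀ (A : Form ℕ n) v → Sat ρ′ v ⟦ subst σ A ⟧⟨ f ⟩ ⇔ Sat ρ v ⟦ A ⟧⟨ f ⟩
  Sat-subst σ h (atom p) v = ⇔.refl
  Sat-subst σ h (var x)  v = ⇔.sym (h x v)
  Sat-subst σ h (A ⇒ B)  v = →-cong-⇔ (Sat-subst σ h A v) (Sat-subst σ h B v)
  Sat-subst σ h (□ A)    v = guarded-cong-⇔ λ w → Sat-subst σ h A w
  Sat-subst σ h (■ A)    v = guarded-cong-⇔ λ u → Sat-subst σ h A u
  Sat-subst σ h (∀' A)   v = ∀-cong-⇔ λ i → Sat-subst (exts σ)
    (λ { zero _ → ⇔.refl ; (suc x) w → ⇔.trans (h x w) (⇔.sym (Sat-rename suc (λ _ _ → ⇔.refl) (σ x) w)) })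
    A v

  Sat-[] : ∀ {f} (A : Form ℕ 1) (C : Fml) {ρ : Fin 1 → Idx} →
           (∀ w → set (ρ zero) w ⇔ w ⊨ ⟦ C ⟧⟨ f ⟩) →
           ∀ v → v ⊨ ⟦ A [ C ] ⟧⟨ f ⟩ ⇔ Sat ρ v ⟦ A ⟧⟨ f ⟩
  Sat-[] A C h v = Sat-subst _ (λ { zero → h }) A v

  gen-valid : ∀ p (A : Form ℕ 1) → Fresh p A →
              (∀ f v → v ⊨ ⟦ A [ atom p ] ⟧⟨ f ⟩) → ∀ f v → v ⊨ ⟦ ∀' A ⟧⟨ f ⟩
  gen-valid p A fresh ⊨A[p] f v i =
    ≡.subst (Sat _ v) (⟦⟧-fresh f i A fresh) (to (Sat-[] A (atom p) p↦i v) (⊨A[p] (f [ p ↦ i ]) v))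
    where
    p↦i : ∀ w → set i w ⇔ set ((f [ p ↦ i ]) p) w
    p↦i w rewrite [↦]-same f p i = ⇔.refl

module Soundness (M : RelModel) (comprehensive : RelModel.Comprehensive M) (em : ExcludedMiddle 0ℓ) where
  open RelModel M
  open Semantics M

  ‖_‖ : Form Idx 0 → Idx
  ‖ C ‖ = proj₁ (comprehensive C)

  ‖‖-⇔ : ∀ C w → set ‖ C ‖ w ⇔ w ⊨ C
  ‖‖-⇔ C = proj₂ (comprehensive C)

  ⊥-elim-⊨ : ∀ (C : Form Idx 0) v → v ⊨ ⊥' → v ⊨ C
  ⊥-elim-⊨ C v ⊨⊥ = to (‖‖-⇔ C v) (⊨⊥ ‖ C ‖)

  inst-valid : ∀ {f} (A : Form ℕ 1) (C : Fml) v → v ⊨ ⟦ ∀' A ⟧⟨ f ⟩ → v ⊨ ⟦ A [ C ] ⟧⟨ f ⟩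
  inst-valid {f} A C v ⊨∀A = from (Sat-[] A C (‖‖-⇔ ⟦ C ⟧⟨ f ⟩) v) (⊨∀A ‖ ⟦ C ⟧⟨ f ⟩ ‖)

  sound : ∀ {A} → Kt2⊢ A → ∀ f v → v ⊨ ⟦ A ⟧⟨ f ⟩
  sound (ax-K A B)        f v = λ a _ → a
  sound (ax-S A B C)      f v = λ g h a → g a (h a)
  sound (ax-inst A C)     f v = inst-valid A C v
  sound (ax-∀⇒ B A)       f v = λ g b i → g i (from (Sat-wk B v) b)
  sound (mp d e)          f v = sound d f v (sound e f v)
  sound (gen p A fresh d)     = gen-valid p A fresh (sound d)
  sound (ax-□ A B)        f v = λ g h w r → g w r (h w r)
  sound (ax-◇ A B)        f v = λ h ◇A i g →
    ◇A i λ w r a → g w r (from (Sat-wk B w) (h w r (to (Sat-wk A w) a)))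
  sound (ax-■ A B)        f v = λ g h u r → g u r (h u r)
  sound (ax-◆ A B)        f v = λ h ◆A i g →
    ◆A i λ u r a → g u r (from (Sat-wk B u) (h u r (to (Sat-wk A u) a)))
  sound (nec-□ d)         f v = λ w _ → sound d f w
  sound (nec-■ d)         f v = λ u _ → sound d f u
  sound (ax-t1 A)         f v = λ ◆□A → to (‖‖-⇔ _ v)
    (◆□A ‖ ⟦ A ⟧⟨ f ⟩ ‖ λ u r □A w r′ → from (‖‖-⇔ _ w) (to (Sat-wk (□ A) u) □A w r′))
  sound (ax-t2 A)         f v = λ a w r i g → g v r (from (Sat-wk A v) a) w r
  sound (ax-t3 A)         f v = λ ◇■A → to (‖‖-⇔ _ v)
    (◇■A ‖ ⟦ A ⟧⟨ f ⟩ ‖ λ w r ■A u r′ → from (‖‖-⇔ _ u) (to (Sat-wk (■ A) w) ■A u r′))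
  sound (ax-t4 A)         f v = λ a u r i g → g v r (from (Sat-wk A v) a) u r
  sound (ax-dne A)        f v ¬¬a with em {v ⊨ ⟦ A ⟧⟨ f ⟩}
  ... | yes a  = a
  ... | no ¬a = ⊥-elim-⊨ ⟦ A ⟧⟨ f ⟩ v (¬¬a λ a → ⊥-elim (¬a a))

theorem3p13 : ExcludedMiddle 0ℓ → ∀ {A : Fml} → Kt2⊢ A → (𝔑 : RelModel) → RelModel.Comprehensive 𝔑 → RelModel.Valid 𝔑 A
theorem3p13 em ⊢A 𝔑 comprehensive = Soundness.sound 𝔑 comprehensive em ⊢A (RelModel.val 𝔑)
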